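{- Let $i,j\in J$ be two jobs with $\varphi_i(0)>\varphi_j(0)$, $w_ip_j\ne w_jp_i$, and $t^*_{ij}\in(0,T)$. If in a complete schedule $S$ job $i$ starts in the time interval $[t^*_{ij},t^*_{ij}+p_j)$, then $S$ is not a potential schedule.
   Context: $J$ is a finite set of jobs; job $j$ has processing time $p_j>0$ and weight $w_j>0$. A complete schedule is an ordering of $J$, the jobs processed consecutively without idle time from time $0$; $t_j$ denotes the start time of $j$. $T=\sum_{j\in J}p_j$. For $t\ge0$, $\varphi_j(t)=\frac{w_j}{p_j(p_j+t)}$. For distinct jobs $i,j$ with $w_ip_j\neq w_jp_i$, $t^*_{ij}=t^*_{ji}=\frac{w_jp_i^2-w_ip_j^2}{w_ip_j-w_jp_i}$, the unique real $t$ with $\varphi_i(t)=\varphi_j(t)$. Dominance rule. For distinct jobs $i,j$: (a) if $\varphi_i(t)\ge\varphi_j(t)$ for all $t\ge0$ and $\varphi_i\not\equiv\varphi_j$, the rule imposes "$i\prec_g j$", which a schedule violates if $j$ is processed before $i$; (b) if neither $\varphi_i\ge\varphi_j$ nor $\varphi_j\ge\varphi_i$ holds on all of $[0,\infty)$, then $t^*_{ij}>0$, and naming the jobs so that $\varphi_i(0)>\varphi_j(0)$ (so $\varphi_i>\varphi_j$ on $[0,t^*_{ij})$ and $\varphi_j\ge\varphi_i$ on $[t^*_{ij},\infty)$), the rule imposes "$i\prec_{g[0,t^*_{ij})}j$", violated if $j$ is processed before $i$ and $t_i-p_j<t^*_{ij}$, and "$j\prec_{g[t^*_{ij},\infty)}i$",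 violated if $i$ is processed before $j$ and $t_i\ge t^*_{ij}$. A complete schedule is a potential schedule if no pair of jobs violates a relation imposed by the rule.
   Formalization: The processing times $p_j$ and weights $w_j$ are rational, and the time $t$ in the dominance rule ranges over the rationals rather than the reals. -}

module Defs where

open import Data.Nat using (ℕ; zero; suc)
open import Data.Fin using (Fin; zero; suc; _<?_) renaming (_<_ to _<ᶠ_)
open import Data.Rational using (ℚ; 0ℚ; _+_; _-_; _*_; _≤_; _<_; _≟_; ≢-nonZero; 1/_)
open import Data.Product using (_×_; ∃)
open import Data.Sum using (_⊎_)
open import Relation.Nullary using (¬_; yes; no; does)
open import Relation.Binary.PropositionalEquality using (_≡_; _≢_)
open import Data.Bool using (if_then_else_)
open import Function.Definitions using (Injective)

-- Total division on ℚ (x / 0 := 0).  Only ever applied to nonzero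
-- denominators in the situations of the paper.
_÷₀_ : ℚ → ℚ → ℚ
x ÷₀ y with y ≟ 0ℚ
... | yes _  = 0ℚ
... | no y≢0 = x * (1/_ y {{≢-nonZero y≢0}})

sumFin : ∀ {n} → (Fin n → ℚ) → ℚ
sumFin {zero}  f = 0ℚ
sumFin {suc n} f = f zero + sumFin (λ k → f (suc k))

φ : ∀ {n} → (p w : Fin n → ℚ) → Fin n → ℚ → ℚ
φ p w j t = w j ÷₀ (p j * (p j + t))

tStar : ∀ {n} → (p w : Fin n → ℚ) → Fin n → Fin n → ℚ
tStar p w i j = (w j * (p i * p i) - w i * (p j * p j)) ÷₀ (w i * p j - w j * p i)

-- A complete schedule: an ordering of the jobs, given by the injective
-- (hence bijective) map  pos : job ↦ position in the sequence.
record Schedule (n : ℕ) : Set where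
  field
    pos : Fin n → Fin n
    pos-inj : Injective _≡_ _≡_ pos
open Schedule public

ProcessedBefore : ∀ {n} → Schedule n → Fin n → Fin n → Set
ProcessedBefore S j i = pos S j <ᶠ pos S i

startTime : ∀ {n} → (p : Fin n → ℚ) → Schedule n → Fin n → ℚ
startTime p S j = sumFin (λ k → if does (pos S k <? pos S j) then p k else 0ℚ)

totalTime : ∀ {n} → (Fin n → ℚ) → ℚ
totalTime p = sumFin p

φ≥on : ∀ {n} → (p w : Fin n → ℚ) → Fin n → Fin n → Set
φ≥on p w i j = ∀ t → 0ℚ ≤ t → φ p w j t ≤ φ p w i t

φ≢ : ∀ {n} → (p w : Fin n → ℚ) → Fin n → Fin n → Set
φ≢ p w i j = ∃ λ t → 0ℚ ≤ t × φ p w i t ≢ φ p w j t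

-- The ordered pair (i, j) makes S violate a relation imposed by the
-- dominance rule (with i in the role of "i" in the rule).
Violates : ∀ {n} → (p w : Fin n → ℚ) → Schedule n → Fin n → Fin n → Set
Violates p w S i j =
  -- (a) i ≺_g j violated
  (φ≥on p w i j × φ≢ p w i j × ProcessedBefore S j i)
  ⊎
  (¬ φ≥on p w i j × ¬ φ≥on p w j i × φ p w j 0ℚ < φ p w i 0ℚ ×
     ( -- i ≺_{g[0,t*)} j violated
       (ProcessedBefore S j i × startTime p S i - p j < tStar p w i j)
     ⊎ -- j ≺_{g[t*,∞)} i violated
       (ProcessedBefore S i j × tStar p w i j ≤ startTime p S i)))

PotentialSchedule : ∀ {n} → (p w : Fin n → ℚ) → Schedule n → Set
PotentialSchedule p w S = ∀ i j → i ≢ j → ¬ Violates p w S i j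

{-# OPTIONS --safe #-}
module Submission where

-- Clearing the (positive) denominators of φ shows that
--   w_j p_i (p_i + t) − w_i p_j (p_j + t) = (t* − t)(w_i p_j − w_j p_i).
-- At t = 0 the left side is negative, and t* > 0, so the denominator of t* is
-- negative; hence φ_i < φ_j beyond t*, and neither job dominates the other on
-- [0, ∞).  The pair (i, j) therefore falls under part (b) of the rule: if i
-- precedes j then t_i ≥ t* violates j ≺ i, and if j precedes i then
-- t_i − p_j < t* violates i ≺ j.

open import Defs
open import Data.Nat using (ℕ)
open import Data.Fin using (Fin)
import Data.Fin.Properties as F
open import Data.Rational
  using (ℚ; 0ℚ; 1ℚ; _+_; _*_; _-_; -_; _≤_; _<_; 1/_; _≟_; positive; negative; ≢-nonZero)
import Data.Rational.Properties as Q
open import Data.Rational.Solver using (module +-*-Solver)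
open import Algebra.Properties.Group Q.+-0-group using (x∙y⁻¹≈ε⇒x≈y)
open import Data.Sum using (_⊎_; inj₁; inj₂)
open import Data.Product using (_×_; _,_)
open import Data.Empty using (⊥-elim)
open import Function.Bundles using (_⇔_; mk⇔; Equivalence)
open import Relation.Nullary using (¬_; yes; no)
open import Relation.Binary.Definitions using (tri<; tri≈; tri>)
open import Relation.Binary.PropositionalEquality
  using (_≡_; _≢_; refl; sym; cong; subst; subst₂; module ≡-Reasoning)

open +-*-Solver
open ≡-Reasoning

<⇒≱ : ∀ {x y : ℚ} → x < y → ¬ y ≤ x
<⇒≱ x<y y≤x = Q.<-irrefl refl (Q.<-≤-trans x<y y≤x)

p<q⇒p-q<0 : ∀ {p q} → p < q → p - q < 0ℚ
p<q⇒p-q<0 {p} {q} p<q = subst (p - q <_) (Q.+-inverseʳ q) (Q.+-monoˡ-< (- q) p<q)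

0<p-q⇒q<p : ∀ {p q} → 0ℚ < p - q → q < p
0<p-q⇒q<p {p} {q} 0<p-q =
  subst₂ _<_ (Q.+-identityʳ q) (solve 2 (λ p q → q :+ (p :- q) := p) refl p q)
    (Q.+-monoʳ-< q 0<p-q)

p<q+r⇒p-r<q : ∀ {p q r} → p < q + r → p - r < q
p<q+r⇒p-r<q {p} {q} {r} p<q+r =
  subst (p - r <_) (solve 2 (λ q r → (q :+ r) :- r := q) refl q r) (Q.+-monoˡ-< (- r) p<q+r)

pos*q<0⇒q<0 : ∀ {p q} → 0ℚ < p → p * q < 0ℚ → q < 0ℚ
pos*q<0⇒q<0 {p} {q} 0<p pq<0 =
  Q.*-cancelˡ-<-nonNeg p {{Q.pos⇒nonNeg p {{positive 0<p}}}} (subst (p * q <_) (sym (Q.*-zeroʳ p)) pq<0)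

neg*neg>0 : ∀ {p q} → p < 0ℚ → q < 0ℚ → 0ℚ < p * q
neg*neg>0 {p} {q} p<0 q<0 = Q.positive⁻¹ (p * q) {{Q.neg*neg⇒pos p {{negative p<0}} q {{negative q<0}}}}

pos*pos>0 : ∀ {p q} → 0ℚ < p → 0ℚ < q → 0ℚ < p * q
pos*pos>0 {p} {q} 0<p 0<q = Q.positive⁻¹ (p * q) {{Q.pos*pos⇒pos p {{positive 0<p}} q {{positive 0<q}}}}

p÷₀q*q≡p : ∀ p {q} → q ≢ 0ℚ → (p ÷₀ q) * q ≡ p
p÷₀q*q≡p p {q} q≢0 with q ≟ 0ℚ
... | yes q≡0 = ⊥-elim (q≢0 q≡0)
... | no _ = begin
  p * 1/q * q    ≡⟨ Q.*-assoc p 1/q q ⟩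
  p * (1/q * q)  ≡⟨ cong (p *_) (Q.*-inverseˡ q {{≢-nonZero q≢0}}) ⟩
  p * 1ℚ         ≡⟨ Q.*-identityʳ p ⟩
  p              ∎
  where 1/q = 1/_ q {{≢-nonZero q≢0}}

÷₀-<-÷₀⇔ : ∀ {a b c d} → 0ℚ < b → 0ℚ < d → (a ÷₀ b < c ÷₀ d) ⇔ (a * d < c * b)
÷₀-<-÷₀⇔ {a} {b} {c} {d} 0<b 0<d = mk⇔
  (λ lt → subst₂ _<_ bd[a÷₀b]≡ad bd[c÷₀d]≡cb (Q.*-monoʳ-<-pos (b * d) {{positive 0<bd}} lt))
  (λ lt → Q.*-cancelˡ-<-nonNeg (b * d) {{Q.pos⇒nonNeg (b * d) {{positive 0<bd}}}}
            (subst₂ _<_ (sym bd[a÷₀b]≡ad) (sym bd[c÷₀d]≡cb) lt))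
  where
  0<bd = pos*pos>0 0<b 0<d
  clear : ∀ x y z → 0ℚ < y → (y * z) * (x ÷₀ y) ≡ x * z
  clear x y z 0<y = begin
    (y * z) * (x ÷₀ y)  ≡⟨ solve 3 (λ y z u → (y :* z) :* u := (u :* y) :* z) refl y z (x ÷₀ y) ⟩
    ((x ÷₀ y) * y) * z  ≡⟨ cong (_* z) (p÷₀q*q≡p x (λ y≡0 → Q.<⇒≢ 0<y (sym y≡0))) ⟩
    x * z               ∎
  bd[a÷₀b]≡ad : (b * d) * (a ÷₀ b) ≡ a * d
  bd[a÷₀b]≡ad = clear a b d 0<b
  bd[c÷₀d]≡cb : (b * d) * (c ÷₀ d) ≡ c * b
  bd[c÷₀d]≡cb = begin
    (b * d) * (c ÷₀ d)  ≡⟨ cong (_* (c ÷₀ d)) (Q.*-comm b d) ⟩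
    (d * b) * (c ÷₀ d)  ≡⟨ clear c d b 0<d ⟩
    c * b               ∎

module _ {n : ℕ} (p w : Fin n → ℚ) where

  φ-cross-difference : ∀ i j t → w i * p j ≢ w j * p i →
    w j * (p i * (p i + t)) - w i * (p j * (p j + t)) ≡ (tStar p w i j - t) * (w i * p j - w j * p i)
  φ-cross-difference i j t w≢ = begin
    w j * (p i * (p i + t)) - w i * (p j * (p j + t))
      ≡⟨ solve 5 (λ wi wj pi pj t →
           wj :* (pi :* (pi :+ t)) :- wi :* (pj :* (pj :+ t))
             := (wj :* (pi :* pi) :- wi :* (pj :* pj)) :- t :* (wi :* pj :- wj :* pi))
           refl (w i) (w j) (p i) (p j) t ⟩
    N - t * D
      ≡⟨ cong (_- t * D) (sym (p÷₀q*q≡p N D≢0)) ⟩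
    tStar p w i j * D - t * D
      ≡⟨ solve 3 (λ s t d → s :* d :- t :* d := (s :- t) :* d) refl (tStar p w i j) t D ⟩
    (tStar p w i j - t) * D ∎
    where
    N = w j * (p i * p i) - w i * (p j * p j)
    D = w i * p j - w j * p i
    D≢0 : D ≢ 0ℚ
    D≢0 D≡0 = w≢ (x∙y⁻¹≈ε⇒x≈y (w i * p j) (w j * p i) D≡0)

  module _ (p>0 : ∀ k → 0ℚ < p k) where

    φ<φ⇔ : ∀ i j {t} → 0ℚ ≤ t →
      (φ p w j t < φ p w i t) ⇔ (w j * (p i * (p i + t)) < w i * (p j * (p j + t)))
    φ<φ⇔ i j {t} 0≤t = ÷₀-<-÷₀⇔ (p[p+t]>0 j) (p[p+t]>0 i)
      where
      p≤p+t : ∀ k → p k ≤ p k + t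
      p≤p+t k = subst (_≤ p k + t) (Q.+-identityʳ (p k)) (Q.+-monoʳ-≤ (p k) 0≤t)
      p[p+t]>0 : ∀ k → 0ℚ < p k * (p k + t)
      p[p+t]>0 k = pos*pos>0 (p>0 k) (Q.<-≤-trans (p>0 k) (p≤p+t k))

    module _ (i j : Fin n) (φⱼ0<φᵢ0 : φ p w j 0ℚ < φ p w i 0ℚ)
             (w≢ : w i * p j ≢ w j * p i) (0<t* : 0ℚ < tStar p w i j) where

      tStar-denominator<0 : w i * p j - w j * p i < 0ℚ
      tStar-denominator<0 = pos*q<0⇒q<0 0<t*-0 (subst (_< 0ℚ) (φ-cross-difference i j 0ℚ w≢) gap<0)
        where
        0<t*-0 : 0ℚ < tStar p w i j - 0ℚ
        0<t*-0 = subst (0ℚ <_) (sym (Q.+-identityʳ _)) 0<t*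
        gap<0 : w j * (p i * (p i + 0ℚ)) - w i * (p j * (p j + 0ℚ)) < 0ℚ
        gap<0 = p<q⇒p-q<0 (Equivalence.to (φ<φ⇔ i j Q.≤-refl) φⱼ0<φᵢ0)

      φ<φ-beyond-tStar : ∀ {t} → tStar p w i j < t → φ p w i t < φ p w j t
      φ<φ-beyond-tStar {t} t*<t = Equivalence.from (φ<φ⇔ j i 0≤t)
        (0<p-q⇒q<p (subst (0ℚ <_) (sym (φ-cross-difference i j t w≢))
          (neg*neg>0 (p<q⇒p-q<0 t*<t) tStar-denominator<0)))
        where
        0≤t = Q.<⇒≤ (Q.<-trans 0<t* t*<t)

processed-before-or-after : ∀ {n} (S : Schedule n) {i j} → i ≢ j →
  ProcessedBefore S i j ⊎ ProcessedBefore S j i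
processed-before-or-after S {i} {j} i≢j with F.<-cmp (pos S i) (pos S j)
... | tri< i<j _ _ = inj₁ i<j
... | tri≈ _ i≡j _ = ⊥-elim (i≢j (pos-inj S i≡j))
... | tri> _ _ j<i = inj₂ j<i

lemma2 : ∀ {n : ℕ} (p w : Fin n → ℚ) →
           (∀ k → 0ℚ < p k) → (∀ k → 0ℚ < w k) →
           (i j : Fin n) →
           φ p w j 0ℚ < φ p w i 0ℚ →
           w i * p j ≢ w j * p i →
           0ℚ < tStar p w i j → tStar p w i j < totalTime p →
           (S : Schedule n) →
           tStar p w i j ≤ startTime p S i →
           startTime p S i < tStar p w i j + p j →
           ¬ PotentialSchedule p w S
lemma2 p w p>0 _ i j φⱼ0<φᵢ0 w≢ 0<t* _ S t*≤tᵢ tᵢ<t*+pⱼ potential =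
  potential i j i≢j (inj₂ (φᵢ≱φⱼ , φⱼ≱φᵢ , φⱼ0<φᵢ0 , violation (processed-before-or-after S i≢j)))
  where
  t* = tStar p w i j
  i≢j : i ≢ j
  i≢j refl = w≢ refl
  φᵢ≱φⱼ : ¬ φ≥on p w i j
  φᵢ≱φⱼ φᵢ≥φⱼ = <⇒≱ (φ<φ-beyond-tStar p w p>0 i j φⱼ0<φᵢ0 w≢ 0<t* t*<t*+1) (φᵢ≥φⱼ (t* + 1ℚ) 0≤t*+1)
    where
    t*<t*+1 = subst (_< t* + 1ℚ) (Q.+-identityʳ t*) (Q.+-monoʳ-< t* (Q.positive⁻¹ 1ℚ))
    0≤t*+1 = Q.<⇒≤ (Q.<-trans 0<t* t*<t*+1)
  φⱼ≱φᵢ : ¬ φ≥on p w j i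
  φⱼ≱φᵢ φⱼ≥φᵢ = <⇒≱ φⱼ0<φᵢ0 (φⱼ≥φᵢ 0ℚ Q.≤-refl)
  violation : ProcessedBefore S i j ⊎ ProcessedBefore S j i →
    (ProcessedBefore S j i × startTime p S i - p j < t*) ⊎ (ProcessedBefore S i j × t* ≤ startTime p S i)
  violation (inj₁ i-first) = inj₂ (i-first , t*≤tᵢ)
  violation (inj₂ j-first) = inj₁ (j-first , p<q+r⇒p-r<q tᵢ<t*+pⱼ)
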